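{- Let $\mathcal{P}=\mathcal{P}_o\uplus\mathcal{P}_u$ be a finite set of atomic propositions, partitioned into observable ones $\mathcal{P}_o$ and unobservable ones $\mathcal{P}_u$. Let $\psi_s$ be a belief state (for some $\mathsf{LTL_f}$ formula $\varphi\in\mathsf{LTL_f}(\mathcal{P})$), let $w_o\in\mathbb{B}^{\mathcal{P}_o}$, and let $\psi_s'$ be the first component of the observable progression $\mathrm{fp}_{\mathrm{obs}}(\psi_s,w_o)$. Let $\sigma\in(\mathbb{B}^{\mathcal{P}})^{+}$ be a finite word and let $i<|\sigma|-1$ be a position with $\sigma(i)|_{\mathcal{P}_o}=w_o$. For $w_u\in\mathbb{B}^{\mathcal{P}_u}$ let $\sigma^{w_u}$ be the word obtained from $\sigma$ by changing only position $i$: $\sigma^{w_u}(i)=w_o\sqcup w_u$ and $\sigma^{w_u}(j)=\sigma(j)$ for $j\neq i$. Then \[ \sigma,i+1\models\psi_s' \quad\text{iff}\quad \forall w_u\in\mathbb{B}^{\mathcal{P}_u}:\ \sigma^{w_u},i\models\psi_s . \]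
   Context: $\mathbb{B}=\{\bot,\top\}$; an assignment is $w:\mathcal{P}\to\mathbb{B}$ (identified with the set of propositions it makes true); for disjoint $\mathcal{P}_1,\mathcal{P}_2$, $w_1\sqcup w_2$ is the combined assignment on $\mathcal{P}_1\cup\mathcal{P}_2$, and $w|_{\mathcal{P}_o}$ is restriction. A finite word $\sigma$ of length $n$ is a map $\{0,\dots,n-1\}\to\mathbb{B}^{\mathcal{P}}$. $\mathsf{LTL_f}(\mathcal{P})$ formulas: $\varphi::=\mathit{tt}\mid\mathit{ff}\mid p\mid\neg\varphi\mid\varphi\odot\varphi\mid \mathsf{X}\varphi\mid\mathsf{X}^{s}\varphi\mid\mathsf{F}\varphi\mid\mathsf{G}\varphi\mid\varphi\,\mathsf{U}\,\varphi\mid\varphi\,\mathsf{R}\,\varphi$ with $p\in\mathcal{P}$ and $\odot$ any binary Boolean connective. Semantics for $\sigma$ of length $n$ and $0\le i<n$: $\sigma,i\models\mathit{tt}$ iff $i<n$; $\sigma,i\models\mathit{ff}$ iff $i=n$; $\sigma,i\models p$ iff $p\in\sigma(i)$; Boolean connectives as usual; $\sigma,i\models\mathsf{X}\varphi$ iff $i+1=n$ or $\sigma,i+1\models\varphi$; $\sigma,i\models\mathsf{X}^s\varphi$ iff $i+1<n$ and $\sigma,i+1\models\varphi$; $\mathsf{F}\varphi$: $\exists j\in[i,n)$ with $\sigma,j\models\varphi$; $\mathsf{G}\varphi$: $\forall j\in[i,n)$, $\sigma,j\models\varphi$; $\varphi_1\mathsf{U}\varphi_2$: $\exists j\in[i,n)$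 with $\sigma,j\models\varphi_2$ and $\forall k\in[i,j)$, $\sigma,k\models\varphi_1$; $\varphi_1\mathsf{R}\varphi_2$: $\forall j\in[i,n)$, $\sigma,j\models\varphi_2$ or $\exists k\in[i,j)$ with $\sigma,k\models\varphi_1$. Propositional equivalence: for $\varphi$, let $\varphi_P$ be the Boolean formula obtained by replacing each maximal temporal subformula $\psi$ (subformula whose main operator is temporal and not strictly inside another temporal subformula) by a fresh Boolean variable $x_\psi$; $\varphi_1\sim\varphi_2$ iff ${\varphi_1}_P,{\varphi_2}_P$ are semantically equivalent. $[\varphi]_\sim$ denotes a fixed unique representative of the $\sim$-class of $\varphi$. Pairs in $\mathsf{LTL_f}(\mathcal{P})\times\mathbb{B}$ are combined by $(\varphi_1,b_1)\odot(\varphi_2,b_2)=([\varphi_1\odot\varphi_2]_\sim,b_1\odot b_2)$, $\neg(\varphi,b)=([\neg\varphi]_\sim,\neg b)$, and for a nonempty finite set $X$ of pairs, $\bigwedge X=(\bigwedge_{(\varphi,b)\in X}\varphi,\bigwedge_{(\varphi,b)\in X}b)$. Formula progression $\mathrm{fp}(\varphi,w)$ for $w\in\mathbb{B}^{\mathcal{P}}$: $\mathrm{fp}(\mathit{tt},w)=(\mathit{tt},\top)$, $\mathrm{fp}(\mathit{ff},w)=(\mathit{ff},\bot)$; $\mathrm{fp}(p,w)=(\mathit{tt},\top)$ if $p\in w$, else $(\mathit{ff},\bot)$; $\mathrm{fp}(\neg\varphi,w)=\neg\mathrm{fp}(\varphi,w)$; $\mathrm{fp}(\varphi_1\odot\varphi_2,w)=\mathrm{fp}(\varphi_1,w)\odot\mathrm{fp}(\varphi_2,w)$;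 $\mathrm{fp}(\mathsf{X}\varphi,w)=(\varphi,\top)$; $\mathrm{fp}(\mathsf{X}^s\varphi,w)=(\varphi,\bot)$; $\mathrm{fp}(\mathsf{F}\varphi,w)=\mathrm{fp}(\varphi,w)\vee(\mathsf{F}\varphi,\bot)$; $\mathrm{fp}(\mathsf{G}\varphi,w)=\mathrm{fp}(\varphi,w)\wedge(\mathsf{G}\varphi,\top)$; $\mathrm{fp}(\varphi_1\mathsf{U}\varphi_2,w)=\mathrm{fp}(\varphi_2,w)\vee(\mathrm{fp}(\varphi_1,w)\wedge(\varphi_1\mathsf{U}\varphi_2,\bot))$; $\mathrm{fp}(\varphi_1\mathsf{R}\varphi_2,w)=\mathrm{fp}(\varphi_2,w)\wedge(\mathrm{fp}(\varphi_1,w)\vee(\varphi_1\mathsf{R}\varphi_2,\top))$. It extends to nonempty words by iterating on the first component. $\mathrm{reach}(\varphi)=\{[\varphi]_\sim\}\cup\{[\varphi']_\sim\mid(\varphi',b)=\mathrm{fp}(\varphi,\sigma),\ \sigma\in(\mathbb{B}^{\mathcal{P}})^+\}$. A belief state is a finite set $s=\{\varphi_1,\dots,\varphi_k\}\subseteq\mathrm{reach}(\varphi)$, identified with the formula $\psi_s=\bigwedge_{\varphi_i\in s}\varphi_i$. Observable progression: $\mathrm{fp}_{\mathrm{obs}}(\psi,w_o)=\bigwedge\{\mathrm{fp}(\psi,w)\mid w\in\mathbb{B}^{\mathcal{P}},\ w|_{\mathcal{P}_o}=w_o\}$. -}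

module Defs where

open import Data.Bool using (Bool; true; false; not; _∧_; _∨_; if_then_else_)
open import Data.Nat using (ℕ; zero; suc; _+_; _∸_; _≡ᵇ_; _<ᵇ_)
open import Data.Fin using (Fin)
open import Data.List using (List; []; _∷_; length; map; upTo)
open import Data.Bool.ListAction using (any; all)
open import Data.List.NonEmpty using (List⁺; _∷_; [_]; foldr₁; concatMap)
import Data.List.NonEmpty as L⁺
open import Data.Product using (_×_; _,_; proj₁; Σ)
open import Data.Sum using (_⊎_; inj₁; inj₂)
import Data.Sum as Sum
open import Data.Vec.Functional using () renaming (_∷_ to _∷ᶠ_)
open import Relation.Binary.PropositionalEquality using (_≡_)

data Formula (P : Set) : Set where
  tt ff : Formula P
  var   : P → Formula P
  neg   : Formula P → Formula P
  bin   : (Bool → Bool → Bool) → Formula P → Formula P → Formula P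
  X Xs F G : Formula P → Formula P
  U R   : Formula P → Formula P → Formula P

module _ {P : Set} where

  Assign : Set
  Assign = P → Bool

  and or : Formula P → Formula P → Formula P
  and = bin _∧_
  or  = bin _∨_

  Word : Set
  Word = List Assign

  -- letter at position i (default value outside the word is irrelevant)
  at : Word → ℕ → Assign
  at []       _       = λ _ → false
  at (w ∷ σ) zero    = w
  at (w ∷ σ) (suc i) = at σ i

  setAt : Word → ℕ → Assign → Word
  setAt []      _       _ = []
  setAt (w ∷ σ) zero    v = v ∷ σ
  setAt (w ∷ σ) (suc i) v = w ∷ setAt σ i v

  range : ℕ → ℕ → List ℕ
  range i n = map (i +_) (upTo (n ∸ i))

  -- Semantics: sat σ i φ ≡ true  means  σ, i ⊨ φ   (meaningful for i < |σ|)
  sat : Word → ℕ → Formula P → Bool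
  sat σ i tt          = true
  sat σ i ff          = false
  sat σ i (var p)     = at σ i p
  sat σ i (neg φ)     = not (sat σ i φ)
  sat σ i (bin o φ ψ) = o (sat σ i φ) (sat σ i ψ)
  sat σ i (X φ)       = if suc i ≡ᵇ length σ then true else sat σ (suc i) φ
  sat σ i (Xs φ)      = if suc i <ᵇ length σ then sat σ (suc i) φ else false
  sat σ i (F φ)       = any (λ j → sat σ j φ) (range i (length σ))
  sat σ i (G φ)       = all (λ j → sat σ j φ) (range i (length σ))
  sat σ i (U φ ψ)     = any (λ j → sat σ j ψ ∧ all (λ k → sat σ k φ) (range i j))
                            (range i (length σ))
  sat σ i (R φ ψ)     = all (λ j → sat σ j ψ ∨ any (λ k → sat σ k φ) (range i j))
                            (range i (length σ))

  -- Propositional equivalence.  φ_P is evaluated under a valuation v of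
  -- the "atoms": the propositions p (var p) and the maximal temporal
  -- subformulas ψ (the fresh variables x_ψ).
  peval : (Formula P → Bool) → Formula P → Bool
  peval v tt          = true
  peval v ff          = false
  peval v (neg φ)     = not (peval v φ)
  peval v (bin o φ ψ) = o (peval v φ) (peval v ψ)
  peval v φ           = v φ

  _∼_ : Formula P → Formula P → Set
  φ ∼ ψ = ∀ (v : Formula P → Bool) → peval v φ ≡ peval v ψ

  record Representative : Set where
    field
      rep      : Formula P → Formula P
      rep-∼    : ∀ φ → rep φ ∼ φ
      rep-uniq : ∀ φ ψ → φ ∼ ψ → rep φ ≡ rep ψ

  module Progression (Rp : Representative) where
    open Representative Rp

    Pair : Set
    Pair = Formula P × Bool

    binP : (Bool → Bool → Bool) → Pair → Pair → Pair
    binP o (φ₁ , b₁) (φ₂ , b₂) = rep (bin o φ₁ φ₂) , o b₁ b₂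

    negP : Pair → Pair
    negP (φ , b) = rep (neg φ) , not b

    _∧P_ _∨P_ : Pair → Pair → Pair
    _∧P_ = binP _∧_
    _∨P_ = binP _∨_

    fp : Formula P → Assign → Pair
    fp tt          w = tt , true
    fp ff          w = ff , false
    fp (var p)     w = if w p then (tt , true) else (ff , false)
    fp (neg φ)     w = negP (fp φ w)
    fp (bin o φ ψ) w = binP o (fp φ w) (fp ψ w)
    fp (X φ)       w = φ , true
    fp (Xs φ)      w = φ , false
    fp (F φ)       w = fp φ w ∨P (F φ , false)
    fp (G φ)       w = fp φ w ∧P (G φ , true)
    fp (U φ ψ)     w = fp ψ w ∨P (fp φ w ∧P (U φ ψ , false))
    fp (R φ ψ)     w = fp ψ w ∧P (fp φ w ∨P (R φ ψ , true))

    fpWord′ : Formula P → Assign → List Assign → Pair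
    fpWord′ φ w []       = fp φ w
    fpWord′ φ w (w′ ∷ σ) = fpWord′ (proj₁ (fp φ w)) w′ σ

    fpWord : Formula P → List⁺ Assign → Pair
    fpWord φ (w ∷ σ) = fpWord′ φ w σ

    InReach : Formula P → Formula P → Set
    InReach φ χ = (χ ≡ rep φ) ⊎ Σ (List⁺ Assign) (λ σ → χ ≡ rep (proj₁ (fpWord φ σ)))

  ⋀ : List⁺ (Formula P) → Formula P
  ⋀ = foldr₁ and

  ⋀P : List⁺ (Formula P × Bool) → Formula P × Bool
  ⋀P = foldr₁ (λ { (φ₁ , b₁) (φ₂ , b₂) → and φ₁ φ₂ , b₁ ∧ b₂ })

-- Observable / unobservable partition  P = P_o ⊎ P_u  with |P_o| = no, |P_u| = nu.

Prop : ℕ → ℕ → Set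
Prop no nu = Fin no ⊎ Fin nu

allAssign : (n : ℕ) → List⁺ (Fin n → Bool)
allAssign zero    = [ (λ ()) ]
allAssign (suc n) = concatMap (λ f → (false ∷ᶠ f) ∷ ((true ∷ᶠ f) ∷ [])) (allAssign n)

_⊔_ : ∀ {no nu} → (Fin no → Bool) → (Fin nu → Bool) → Assign {Prop no nu}
wo ⊔ wu = Sum.[ wo , wu ]

restrictO : ∀ {no nu} → Assign {Prop no nu} → (Fin no → Bool)
restrictO w p = w (inj₁ p)

module _ {no nu : ℕ} (Rp : Representative {Prop no nu}) where
  open Progression Rp

  fpObs : Formula (Prop no nu) → (Fin no → Bool) → Formula (Prop no nu) × Bool
  fpObs ψ wo = ⋀P (L⁺.map (λ wu → fp ψ (wo ⊔ wu)) (allAssign nu))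

{-# OPTIONS --safe #-}
module Submission where

-- Formula progression is sound letter by letter: if i + 1 < |σ|, then σ, i + 1 ⊨ fp(ψ, w)
-- iff the word obtained by writing w at position i satisfies ψ at i.  Satisfaction at i + 1
-- only sees the suffix from i + 1, so the letter at i may be replaced freely, and the clauses
-- of fp are exactly the LTLf expansion laws at a non-final position, e.g.
-- φ U ψ ≡ ψ ∨ (φ ∧ Xˢ (φ U ψ)).  The first component of fp_obs(ψ, w_o) is the conjunction of
-- fp(ψ, w_o ⊔ w_u) over the enumeration allAssign of all w_u; since that enumeration contains
-- every w_u up to pointwise equality, it holds at i + 1 iff every σ^{w_u} satisfies ψ at i.

open import Defs
open import Algebra.Bundles using (CommutativeMonoid)
import Algebra.Properties.CommutativeSemigroup as CommutativeSemigroupProperties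
open import Data.Bool using (Bool; true; false; not; _∧_; _∨_; if_then_else_)
open import Data.Bool.ListAction using (any; all)
import Data.Bool.ListAction as ListAction
open import Data.Bool.Properties
  using (∧-identityʳ; ∨-identityʳ; ∧-zeroʳ; ∨-zeroʳ; ∧-distribˡ-∨; ∨-distribˡ-∧;
         ∧-commutativeMonoid; ∨-commutativeMonoid; ¬-not; T-≡)
open import Data.Fin using (Fin; zero; suc)
open import Data.List using ([]; _∷_; length; map; upTo; applyUpTo)
open import Data.List.NonEmpty using (List⁺; _∷_; toList)
import Data.List.NonEmpty as L⁺
open import Data.List.NonEmpty.Properties using (toList->>=)
open import Data.List.Properties using (map-cong; map-cong-local; map-∘; map-upTo)
open import Data.List.Relation.Unary.All as All using (All)
import Data.List.Relation.Unary.All.Properties as Allₚ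
open import Data.List.Relation.Unary.Any using (Any; here; there)
import Data.List.Relation.Unary.Any as Any
import Data.List.Relation.Unary.Any.Properties as Anyₚ
open import Data.Nat using (ℕ; zero; suc; _≤_; _<_; _+_; _∸_; s≤s; z≤n; _≡ᵇ_; _<ᵇ_)
open import Data.Nat.Properties
  using (≤-refl; ≤-trans; m≤m+n; m≤n⇒m≤1+n; +-∸-assoc; +-identityʳ; +-suc; n∸n≡0; <⇒≤; <⇒≢; <⇒<ᵇ; ≡ᵇ⇒≡)
open import Data.Product using (_×_; _,_; proj₁)
open import Data.Sum using (inj₁; inj₂)
open import Data.Vec.Functional using (tail) renaming (_∷_ to _∷ᶠ_)
open import Function using (_∘_; Equivalence)
open import Function.Bundles using (_⇔_; mk⇔)
open import Relation.Binary.PropositionalEquality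
  using (_≡_; _≢_; _≗_; refl; sym; trans; cong; cong₂; subst)
open Relation.Binary.PropositionalEquality.≡-Reasoning

open Equivalence using (to; from)

≡ᵇ-false : ∀ {m n} → m ≢ n → (m ≡ᵇ n) ≡ false
≡ᵇ-false {m} {n} m≢n = ¬-not (m≢n ∘ ≡ᵇ⇒≡ m n ∘ from T-≡)

<ᵇ-true : ∀ {m n} → m < n → (m <ᵇ n) ≡ true
<ᵇ-true = to T-≡ ∘ <⇒<ᵇ

∧-swap : ∀ x y z → x ∧ (y ∧ z) ≡ y ∧ (x ∧ z)
∧-swap = CommutativeSemigroupProperties.x∙yz≈y∙xz
  (CommutativeMonoid.commutativeSemigroup ∧-commutativeMonoid)

∨-swap : ∀ x y z → x ∨ (y ∨ z) ≡ y ∨ (x ∨ z)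
∨-swap = CommutativeSemigroupProperties.x∙yz≈y∙xz
  (CommutativeMonoid.commutativeSemigroup ∨-commutativeMonoid)

module _ {A : Set} where

  ∧-any : ∀ a (h : A → Bool) xs → any (λ x → a ∧ h x) xs ≡ a ∧ any h xs
  ∧-any a h []       = sym (∧-zeroʳ a)
  ∧-any a h (x ∷ xs) = trans (cong (a ∧ h x ∨_) (∧-any a h xs)) (sym (∧-distribˡ-∨ a _ _))

  ∨-all : ∀ a (h : A → Bool) xs → all (λ x → a ∨ h x) xs ≡ a ∨ all h xs
  ∨-all a h []       = sym (∨-zeroʳ a)
  ∨-all a h (x ∷ xs) = trans (cong ((a ∨ h x) ∧_) (∨-all a h xs)) (sym (∨-distribˡ-∧ a _ _))

  all≡true⇒All : ∀ {p : A → Bool} {xs} → all p xs ≡ true → All (λ x → p x ≡ true) xs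
  all≡true⇒All {p} {xs} = All.map (to T-≡) ∘ Allₚ.all⁺ p xs ∘ from T-≡

  All⇒all≡true : ∀ {p : A → Bool} {xs} → All (λ x → p x ≡ true) xs → all p xs ≡ true
  All⇒all≡true {p} = to T-≡ ∘ Allₚ.all⁻ p ∘ All.map (from T-≡)

-- Defs declares range inside its module over P, so it carries P as a phantom implicit argument.
module _ {P : Set} where

  range-lowerBound : ∀ i n → All (i ≤_) (range {P} i n)
  range-lowerBound i n = Allₚ.map⁺ (All.universal (m≤m+n i) (upTo (n ∸ i)))

  range-self : ∀ i → range {P} i i ≡ []
  range-self i = cong (map (i +_) ∘ upTo) (n∸n≡0 i)

  range-step : ∀ {i n} → i < n → range {P} i n ≡ i ∷ range {P} (suc i) n
  range-step {i} {suc n} (s≤s i≤n) rewrite +-∸-assoc 1 i≤n =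
    cong₂ _∷_ (+-identityʳ i) (begin
      map (i +_) (applyUpTo suc (n ∸ i))      ≡⟨ cong (map (i +_)) (map-upTo suc (n ∸ i)) ⟨
      map (i +_) (map suc (upTo (n ∸ i)))     ≡⟨ map-∘ (upTo (n ∸ i)) ⟨
      map ((i +_) ∘ suc) (upTo (n ∸ i))       ≡⟨ map-cong (+-suc i) (upTo (n ∸ i)) ⟩
      map (suc i +_) (upTo (n ∸ i))           ∎)

  any-range-cong : ∀ {f g : ℕ → Bool} i n → (∀ {j} → i ≤ j → f j ≡ g j)
                 → any f (range {P} i n) ≡ any g (range {P} i n)
  any-range-cong i n f≡g = cong ListAction.or (map-cong-local (All.map f≡g (range-lowerBound i n)))

  all-range-cong : ∀ {f g : ℕ → Bool} i n → (∀ {j} → i ≤ j → f j ≡ g j)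
                 → all f (range {P} i n) ≡ all g (range {P} i n)
  all-range-cong i n f≡g = cong ListAction.and (map-cong-local (All.map f≡g (range-lowerBound i n)))

  sat≡peval : ∀ (σ : Word {P}) j χ → sat σ j χ ≡ peval (sat σ j) χ
  sat≡peval σ j tt          = refl
  sat≡peval σ j ff          = refl
  sat≡peval σ j (neg χ)     = cong not (sat≡peval σ j χ)
  sat≡peval σ j (bin o χ ψ) = cong₂ o (sat≡peval σ j χ) (sat≡peval σ j ψ)
  sat≡peval σ j (var p)     = refl
  sat≡peval σ j (X χ)       = refl
  sat≡peval σ j (Xs χ)      = refl
  sat≡peval σ j (F χ)       = refl
  sat≡peval σ j (G χ)       = refl
  sat≡peval σ j (U χ ψ)     = refl
  sat≡peval σ j (R χ ψ)     = refl

  sat-local : ∀ {σ σ' : Word {P}} m → length σ ≡ length σ' → (∀ {j} → m ≤ j → at σ j ≗ at σ' j)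
            → ∀ χ {j} → m ≤ j → sat σ j χ ≡ sat σ' j χ
  sat-local {σ} {σ'} m len agree = go
    where
    go : ∀ χ {j} → m ≤ j → sat σ j χ ≡ sat σ' j χ
    go tt          m≤j = refl
    go ff          m≤j = refl
    go (var p)     m≤j = agree m≤j p
    go (neg χ)     m≤j = cong not (go χ m≤j)
    go (bin o χ ψ) m≤j = cong₂ o (go χ m≤j) (go ψ m≤j)
    go (X χ)  {j}  m≤j = cong₂ (λ n b → if suc j ≡ᵇ n then true else b) len (go χ (m≤n⇒m≤1+n m≤j))
    go (Xs χ) {j}  m≤j = cong₂ (λ n b → if suc j <ᵇ n then b else false) len (go χ (m≤n⇒m≤1+n m≤j))
    go (F χ)  {j}  m≤j rewrite len = any-range-cong j _ (λ j≤k → go χ (≤-trans m≤j j≤k))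
    go (G χ)  {j}  m≤j rewrite len = all-range-cong j _ (λ j≤k → go χ (≤-trans m≤j j≤k))
    go (U φ ψ) {j} m≤j rewrite len = any-range-cong j _ λ j≤k →
      cong₂ _∧_ (go ψ (≤-trans m≤j j≤k)) (all-range-cong j _ (λ j≤l → go φ (≤-trans m≤j j≤l)))
    go (R φ ψ) {j} m≤j rewrite len = all-range-cong j _ λ j≤k →
      cong₂ _∨_ (go ψ (≤-trans m≤j j≤k)) (any-range-cong j _ (λ j≤l → go φ (≤-trans m≤j j≤l)))

  module _ {σ : Word {P}} {i : ℕ} (i<n : i < length σ) where

    sat-F-unfold : ∀ φ → sat σ i (F φ) ≡ sat σ i φ ∨ sat σ (suc i) (F φ)
    sat-F-unfold φ = cong (any (λ j → sat σ j φ)) (range-step i<n)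

    sat-G-unfold : ∀ φ → sat σ i (G φ) ≡ sat σ i φ ∧ sat σ (suc i) (G φ)
    sat-G-unfold φ = cong (all (λ j → sat σ j φ)) (range-step i<n)

    sat-U-unfold : ∀ φ ψ → sat σ i (U φ ψ) ≡ sat σ i ψ ∨ (sat σ i φ ∧ sat σ (suc i) (U φ ψ))
    sat-U-unfold φ ψ = begin
      any (until i) (range {P} i n)
        ≡⟨ cong (any (until i)) (range-step i<n) ⟩
      until i i ∨ any (until i) (range {P} (suc i) n)
        ≡⟨ cong₂ _∨_ first rest ⟩
      sat σ i ψ ∨ any (λ j → sat σ i φ ∧ until (suc i) j) (range {P} (suc i) n)
        ≡⟨ cong (sat σ i ψ ∨_) (∧-any (sat σ i φ) (until (suc i)) (range {P} (suc i) n)) ⟩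
      sat σ i ψ ∨ (sat σ i φ ∧ sat σ (suc i) (U φ ψ))
        ∎
      where
      n = length σ
      until : ℕ → ℕ → Bool
      until k j = sat σ j ψ ∧ all (λ l → sat σ l φ) (range {P} k j)
      first : until i i ≡ sat σ i ψ
      first = trans (cong (λ ks → sat σ i ψ ∧ all (λ l → sat σ l φ) ks) (range-self i)) (∧-identityʳ _)
      rest : any (until i) (range {P} (suc i) n) ≡ any (λ j → sat σ i φ ∧ until (suc i) j) (range {P} (suc i) n)
      rest = any-range-cong (suc i) n λ {j} i<j →
        trans (cong (λ ks → sat σ j ψ ∧ all (λ l → sat σ l φ) ks) (range-step i<j))
              (∧-swap (sat σ j ψ) (sat σ i φ) _)

    sat-R-unfold : ∀ φ ψ → sat σ i (R φ ψ) ≡ sat σ i ψ ∧ (sat σ i φ ∨ sat σ (suc i) (R φ ψ))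
    sat-R-unfold φ ψ = begin
      all (release i) (range {P} i n)
        ≡⟨ cong (all (release i)) (range-step i<n) ⟩
      release i i ∧ all (release i) (range {P} (suc i) n)
        ≡⟨ cong₂ _∧_ first rest ⟩
      sat σ i ψ ∧ all (λ j → sat σ i φ ∨ release (suc i) j) (range {P} (suc i) n)
        ≡⟨ cong (sat σ i ψ ∧_) (∨-all (sat σ i φ) (release (suc i)) (range {P} (suc i) n)) ⟩
      sat σ i ψ ∧ (sat σ i φ ∨ sat σ (suc i) (R φ ψ))
        ∎
      where
      n = length σ
      release : ℕ → ℕ → Bool
      release k j = sat σ j ψ ∨ any (λ l → sat σ l φ) (range {P} k j)
      first : release i i ≡ sat σ i ψ
      first = trans (cong (λ ks → sat σ i ψ ∨ any (λ l → sat σ l φ) ks) (range-self i)) (∨-identityʳ _)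
      rest : all (release i) (range {P} (suc i) n) ≡ all (λ j → sat σ i φ ∨ release (suc i) j) (range {P} (suc i) n)
      rest = all-range-cong (suc i) n λ {j} i<j →
        trans (cong (λ ks → sat σ j ψ ∨ any (λ l → sat σ l φ) ks) (range-step i<j))
              (∨-swap (sat σ j ψ) (sat σ i φ) _)

  sat-⋀P-map : ∀ {A : Set} (σ : Word {P}) j (h : A → Formula P × Bool) (xs : List⁺ A)
             → sat σ j (proj₁ (⋀P (L⁺.map h xs))) ≡ all (λ x → sat σ j (proj₁ (h x))) (toList xs)
  sat-⋀P-map σ j h (x ∷ xs) = go x xs
    where
    go : ∀ x xs → sat σ j (proj₁ (⋀P (L⁺.map h (x ∷ xs)))) ≡ all (λ x → sat σ j (proj₁ (h x))) (x ∷ xs)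
    go x []       = sym (∧-identityʳ _)
    go x (y ∷ ys) = cong (sat σ j (proj₁ (h x)) ∧_) (go y ys)

  length-setAt : ∀ (σ : Word {P}) i v → length (setAt σ i v) ≡ length σ
  length-setAt []      i       v = refl
  length-setAt (w ∷ σ) zero    v = refl
  length-setAt (w ∷ σ) (suc i) v = cong suc (length-setAt σ i v)

  at-setAt-same : ∀ (σ : Word {P}) {i} v → i < length σ → at (setAt σ i v) i ≡ v
  at-setAt-same (w ∷ σ) {zero}  v _         = refl
  at-setAt-same (w ∷ σ) {suc i} v (s≤s i<n) = at-setAt-same σ v i<n

  at-setAt-other : ∀ (σ : Word {P}) {i j} v → i < j → at (setAt σ i v) j ≡ at σ j
  at-setAt-other []      {i}     {j}     v _         = refl
  at-setAt-other (w ∷ σ) {zero}  {suc j} v _         = refl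
  at-setAt-other (w ∷ σ) {suc i} {suc j} v (s≤s i<j) = at-setAt-other σ v i<j

  at-setAt-cong : ∀ (σ : Word {P}) i {v v'} → v ≗ v' → ∀ j → at (setAt σ i v) j ≗ at (setAt σ i v') j
  at-setAt-cong []      i       v≗v' j       = λ _ → refl
  at-setAt-cong (w ∷ σ) zero    v≗v' zero    = v≗v'
  at-setAt-cong (w ∷ σ) zero    v≗v' (suc j) = λ _ → refl
  at-setAt-cong (w ∷ σ) (suc i) v≗v' zero    = λ _ → refl
  at-setAt-cong (w ∷ σ) (suc i) v≗v' (suc j) = at-setAt-cong σ i v≗v' j

  sat-setAt-later : ∀ (σ : Word {P}) {i j} v χ → i < j → sat (setAt σ i v) j χ ≡ sat σ j χ
  sat-setAt-later σ {i} v χ =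
    sat-local (suc i) (length-setAt σ i v) (λ i<j p → cong (λ w → w p) (at-setAt-other σ v i<j)) χ

  sat-setAt-cong : ∀ (σ : Word {P}) i {v v'} → v ≗ v' → ∀ j χ → sat (setAt σ i v) j χ ≡ sat (setAt σ i v') j χ
  sat-setAt-cong σ i {v} {v'} v≗v' j χ =
    sat-local 0 (trans (length-setAt σ i v) (sym (length-setAt σ i v'))) (λ {k} _ → at-setAt-cong σ i v≗v' k) χ z≤n

module _ {P : Set} (Rp : Representative {P}) where
  open Representative Rp
  open Progression Rp

  sat-rep : ∀ (σ : Word {P}) j χ → sat σ j (rep χ) ≡ sat σ j χ
  sat-rep σ j χ = begin
    sat σ j (rep χ)           ≡⟨ sat≡peval σ j (rep χ) ⟩
    peval (sat σ j) (rep χ)   ≡⟨ rep-∼ χ (sat σ j) ⟩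
    peval (sat σ j) χ         ≡⟨ sat≡peval σ j χ ⟨
    sat σ j χ                 ∎

  sat-binP : ∀ (σ : Word {P}) j o p q → sat σ j (proj₁ (binP o p q)) ≡ o (sat σ j (proj₁ p)) (sat σ j (proj₁ q))
  sat-binP σ j o (φ , _) (ψ , _) = sat-rep σ j (bin o φ ψ)

  sat-negP : ∀ (σ : Word {P}) j p → sat σ j (proj₁ (negP p)) ≡ not (sat σ j (proj₁ p))
  sat-negP σ j (φ , _) = sat-rep σ j (neg φ)

  sat-fp : ∀ {σ : Word {P}} {i} → suc i < length σ → ∀ ψ → sat σ (suc i) (proj₁ (fp ψ (at σ i))) ≡ sat σ i ψ
  sat-fp {σ} {i} i+1<n = go
    where
    i<n : i < length σ
    i<n = <⇒≤ i+1<n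
    w = at σ i
    S : Pair → Bool
    S = sat σ (suc i) ∘ proj₁
    S-binP : ∀ o p q → S (binP o p q) ≡ o (S p) (S q)
    S-binP = sat-binP σ (suc i)
    go : ∀ ψ → S (fp ψ w) ≡ sat σ i ψ
    go tt          = refl
    go ff          = refl
    go (var p) with w p
    ... | true  = refl
    ... | false = refl
    go (neg ψ)     = trans (sat-negP σ (suc i) (fp ψ w)) (cong not (go ψ))
    go (bin o φ ψ) = trans (S-binP o (fp φ w) (fp ψ w)) (cong₂ o (go φ) (go ψ))
    go (X ψ)       = cong (λ b → if b then true else sat σ (suc i) ψ) (sym (≡ᵇ-false (<⇒≢ i+1<n)))
    go (Xs ψ)      = cong (λ b → if b then sat σ (suc i) ψ else false) (sym (<ᵇ-true i+1<n))
    go (F ψ) = begin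
      S (fp ψ w ∨P (F ψ , false))                   ≡⟨ S-binP _∨_ (fp ψ w) (F ψ , false) ⟩
      S (fp ψ w) ∨ sat σ (suc i) (F ψ)              ≡⟨ cong (_∨ _) (go ψ) ⟩
      sat σ i ψ ∨ sat σ (suc i) (F ψ)               ≡⟨ sat-F-unfold i<n ψ ⟨
      sat σ i (F ψ)                                 ∎
    go (G ψ) = begin
      S (fp ψ w ∧P (G ψ , true))                    ≡⟨ S-binP _∧_ (fp ψ w) (G ψ , true) ⟩
      S (fp ψ w) ∧ sat σ (suc i) (G ψ)              ≡⟨ cong (_∧ _) (go ψ) ⟩
      sat σ i ψ ∧ sat σ (suc i) (G ψ)               ≡⟨ sat-G-unfold i<n ψ ⟨
      sat σ i (G ψ)                                 ∎
    go (U φ ψ) = begin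
      S (fp ψ w ∨P (fp φ w ∧P (U φ ψ , false)))
        ≡⟨ S-binP _∨_ (fp ψ w) (fp φ w ∧P (U φ ψ , false)) ⟩
      S (fp ψ w) ∨ S (fp φ w ∧P (U φ ψ , false))
        ≡⟨ cong (S (fp ψ w) ∨_) (S-binP _∧_ (fp φ w) (U φ ψ , false)) ⟩
      S (fp ψ w) ∨ (S (fp φ w) ∧ sat σ (suc i) (U φ ψ))
        ≡⟨ cong₂ (λ a b → a ∨ (b ∧ _)) (go ψ) (go φ) ⟩
      sat σ i ψ ∨ (sat σ i φ ∧ sat σ (suc i) (U φ ψ))
        ≡⟨ sat-U-unfold i<n φ ψ ⟨
      sat σ i (U φ ψ)
        ∎
    go (R φ ψ) = begin
      S (fp ψ w ∧P (fp φ w ∨P (R φ ψ , true)))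
        ≡⟨ S-binP _∧_ (fp ψ w) (fp φ w ∨P (R φ ψ , true)) ⟩
      S (fp ψ w) ∧ S (fp φ w ∨P (R φ ψ , true))
        ≡⟨ cong (S (fp ψ w) ∧_) (S-binP _∨_ (fp φ w) (R φ ψ , true)) ⟩
      S (fp ψ w) ∧ (S (fp φ w) ∨ sat σ (suc i) (R φ ψ))
        ≡⟨ cong₂ (λ a b → a ∧ (b ∨ _)) (go ψ) (go φ) ⟩
      sat σ i ψ ∧ (sat σ i φ ∨ sat σ (suc i) (R φ ψ))
        ≡⟨ sat-R-unfold i<n φ ψ ⟨
      sat σ i (R φ ψ)
        ∎

  sat-fp-setAt : ∀ {σ : Word {P}} {i} → suc i < length σ → ∀ ψ w
               → sat σ (suc i) (proj₁ (fp ψ w)) ≡ sat (setAt σ i w) i ψ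
  sat-fp-setAt {σ} {i} i+1<n ψ w = begin
    sat σ (suc i) (proj₁ (fp ψ w))
      ≡⟨ sat-setAt-later σ w (proj₁ (fp ψ w)) ≤-refl ⟨
    sat σ′ (suc i) (proj₁ (fp ψ w))
      ≡⟨ cong (λ v → sat σ′ (suc i) (proj₁ (fp ψ v))) (at-setAt-same σ w (<⇒≤ i+1<n)) ⟨
    sat σ′ (suc i) (proj₁ (fp ψ (at σ′ i)))
      ≡⟨ sat-fp (subst (suc i <_) (sym (length-setAt σ i w)) i+1<n) ψ ⟩
    sat σ′ i ψ
      ∎
    where
    σ′ = setAt σ i w

allAssign-complete : ∀ n (f : Fin n → Bool) → Any (_≗ f) (toList (allAssign n))
allAssign-complete zero    f = here (λ ())
allAssign-complete (suc n) f =
  subst (Any (_≗ f)) (toList->>= extensions (allAssign n))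
    (Anyₚ.concatMap⁺ (toList ∘ extensions) (Any.map extend (allAssign-complete n (tail f))))
  where
  extensions : (Fin n → Bool) → List⁺ (Fin (suc n) → Bool)
  extensions g = (false ∷ᶠ g) ∷ (true ∷ᶠ g) ∷ []
  extend : ∀ {g} → g ≗ tail f → Any (_≗ f) (toList (extensions g))
  extend g≗ with f zero in f0
  ... | false = here λ { zero → sym f0 ; (suc k) → g≗ k }
  ... | true  = there (here λ { zero → sym f0 ; (suc k) → g≗ k })

all-allAssign⇔ : ∀ {n} (Q : (Fin n → Bool) → Bool) → (∀ {f g} → f ≗ g → Q f ≡ Q g)
               → all Q (toList (allAssign n)) ≡ true ⇔ (∀ f → Q f ≡ true)
all-allAssign⇔ {n} Q Q-resp = mk⇔
  (λ Q-all f → All.lookupWith (λ Qg g≗f → trans (sym (Q-resp g≗f)) Qg)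
                               (all≡true⇒All Q-all) (allAssign-complete n f))
  (λ Q-all → All⇒all≡true {xs = toList (allAssign n)} (All.universal Q-all _))

lemma1 : ∀ {no nu : ℕ} (Rp : Representative {Prop no nu})
    (φ : Formula (Prop no nu)) (s : List⁺ (Formula (Prop no nu)))
    → All (Progression.InReach Rp φ) (toList s)
    → (wo : Fin no → Bool) (σ : Word {Prop no nu}) (i : ℕ)
    → suc i < length σ
    → (∀ (p : Fin no) → restrictO (at σ i) p ≡ wo p)
    → (sat σ (suc i) (proj₁ (fpObs Rp (⋀ s) wo)) ≡ true)
    ⇔ (∀ (wu : Fin nu → Bool) → sat (setAt σ i (wo ⊔ wu)) i (⋀ s) ≡ true)
lemma1 {nu = nu} Rp φ s _ wo σ i i+1<n _ =
  subst (λ b → b ≡ true ⇔ (∀ wu → Q wu ≡ true)) (sym fpObs≡all) (all-allAssign⇔ Q Q-resp)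
  where
  open Progression Rp
  Q : (Fin nu → Bool) → Bool
  Q wu = sat (setAt σ i (wo ⊔ wu)) i (⋀ s)
  Q-resp : ∀ {wu wu'} → wu ≗ wu' → Q wu ≡ Q wu'
  Q-resp wu≗wu' = sat-setAt-cong σ i (λ { (inj₁ p) → refl ; (inj₂ p) → wu≗wu' p }) i (⋀ s)
  fpObs≡all : sat σ (suc i) (proj₁ (fpObs Rp (⋀ s) wo)) ≡ all Q (toList (allAssign nu))
  fpObs≡all = begin
    sat σ (suc i) (proj₁ (fpObs Rp (⋀ s) wo))
      ≡⟨ sat-⋀P-map σ (suc i) (λ wu → fp (⋀ s) (wo ⊔ wu)) (allAssign nu) ⟩
    all (λ wu → sat σ (suc i) (proj₁ (fp (⋀ s) (wo ⊔ wu)))) (toList (allAssign nu))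
      ≡⟨ cong ListAction.and (map-cong (λ wu → sat-fp-setAt Rp i+1<n (⋀ s) (wo ⊔ wu)) (toList (allAssign nu))) ⟩
    all Q (toList (allAssign nu)) ∎
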